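{- Let $X\subseteq\mathbb{N}$ be infinite. Then there is no nonprincipal ultrafilter $\mathcal{U}$ on $\mathbb{N}$ with $X\in\mathcal{U}$ such that $\mathcal{U}\leq_{fe}\mathcal{V}$ for every nonprincipal ultrafilter $\mathcal{V}$ on $\mathbb{N}$ with $X\in\mathcal{V}$; i.e., $((\Theta_X\setminus\mathbb{N})/\equiv_{fe},\leq_{fe})$ has no minimum.
   Context: $\mathbb{N}=\{0,1,2,\dots\}$; $\Theta_X=\{\mathcal{U}\in\beta\mathbb{N}\mid X\in\mathcal{U}\}$, and principal ultrafilters are identified with natural numbers, so $\Theta_X\setminus\mathbb{N}$ is the set of nonprincipal ultrafilters containing $X$. For $A,B\subseteq\mathbb{N}$, $A\leq_{fe}B$ means that for every finite $F\subseteq A$ there is $k\in\mathbb{N}$ with $F+k\subseteq B$. For ultrafilters, $\mathcal{U}\leq_{fe}\mathcal{V}$ means that for every $B\in\mathcal{V}$ there is $A\in\mathcal{U}$ with $A\leq_{fe}B$; $\equiv_{fe}$ is the associated equivalence. -}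

module Defs where

open import Level using (Level; 0ℓ) renaming (suc to lsuc)
open import Data.Nat using (ℕ; _+_; _≤_)
open import Data.List using (List)
open import Data.List.Relation.Unary.All using (All)
open import Data.Product using (Σ; ∃; _×_)
open import Data.Sum using (_⊎_)
open import Data.Empty using (⊥)
open import Relation.Nullary using (¬_)
open import Relation.Binary.PropositionalEquality using (_≡_)

SubsetN : Set₁
SubsetN = ℕ → Set

_⊆N_ : SubsetN → SubsetN → Set
A ⊆N B = ∀ n → A n → B n

_∩N_ : SubsetN → SubsetN → SubsetN
(A ∩N B) n = A n × B n

∁N : SubsetN → SubsetN
∁N A n = ¬ A n

∅N : SubsetN
∅N _ = ⊥

singletonN : ℕ → SubsetN
singletonN k m = m ≡ k

Family : Set₁
Family = SubsetN → Set

record IsUltrafilter (U : Family) : Set₁ where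
  field
    upward  : ∀ A B → A ⊆N B → U A → U B
    inter   : ∀ A B → U A → U B → U (A ∩N B)
    proper  : ¬ U ∅N
    ultra   : ∀ A → U A ⊎ U (∁N A)

Nonprincipal : Family → Set
Nonprincipal U = ∀ k → ¬ U (singletonN k)

Infinite : SubsetN → Set
Infinite X = ∀ n → ∃ λ m → n ≤ m × X m

-- A ≤_fe B : every finite F ⊆ A (given as a list of elements of A)
-- has a translate F + k ⊆ B.
_≤fe_ : SubsetN → SubsetN → Set
A ≤fe B = ∀ (F : List ℕ) → All A F → ∃ λ k → All (λ x → B (x + k)) F

_≤feU_ : Family → Family → Set₁
U ≤feU V = ∀ B → V B → Σ SubsetN λ A → U A × (A ≤fe B)

-- Inside an infinite X pick a super-increasing sequence x (each term exceeds twice the previous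
-- one), so that a positive difference x q − x p determines q. Push a would-be minimum U forward
-- along the even-indexed and the odd-indexed terms of x: both images are nonprincipal and contain
-- X, so U has members A ≤fe {x 2n} and A' ≤fe {x (2n+1)}. Two elements a < b of A ∩ A' then
-- realise the gap b − a both as x 2j − x 2i and as x (2j'+1) − x (2i'+1), forcing 2j = 2j' + 1.
module Submission where

open import Defs
open import Data.Nat using (ℕ; zero; suc; _+_; _*_; _≤_; _<_; _≤′_; ≤′-refl; ≤′-step; z≤n; s≤s)
open import Data.Nat.Properties
open import Data.Nat.Tactic.RingSolver using (solve-∀)
open import Data.Product using (Σ; ∃; ∃₂; _×_; _,_; proj₁; proj₂)
open import Data.Sum using (inj₁; inj₂)
open import Data.Empty using (⊥-elim)
open import Data.List using ([]; _∷_)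
open import Data.List.Relation.Unary.All using ([]; _∷_)
open import Relation.Nullary using (¬_)
open import Relation.Binary using (tri<; tri≈; tri>)
open import Relation.Binary.PropositionalEquality

SuperIncreasing : (ℕ → ℕ) → Set
SuperIncreasing x = ∀ n → x n + x n < x (suc n)

superIncreasing-within : ∀ {X} → Infinite X →
  Σ (ℕ → ℕ) λ x → SuperIncreasing x × (∀ n → X (x n))
superIncreasing-within {X} X-infinite = x , x-superIncreasing , x∈X
  where
  x : ℕ → ℕ
  x zero    = proj₁ (X-infinite 0)
  x (suc n) = proj₁ (X-infinite (suc (x n + x n)))

  x-superIncreasing : SuperIncreasing x
  x-superIncreasing n = proj₁ (proj₂ (X-infinite (suc (x n + x n))))

  x∈X : ∀ n → X (x n)
  x∈X zero    = proj₂ (proj₂ (X-infinite 0))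
  x∈X (suc n) = proj₂ (proj₂ (X-infinite (suc (x n + x n))))

module SuperIncreasing (x : ℕ → ℕ) (x-superIncreasing : SuperIncreasing x) where

  x<x-suc : ∀ n → x n < x (suc n)
  x<x-suc n = ≤-<-trans (m≤m+n (x n) (x n)) (x-superIncreasing n)

  mono-≤′ : ∀ {m n} → m ≤′ n → x m ≤ x n
  mono-≤′ ≤′-refl        = ≤-refl
  mono-≤′ (≤′-step m≤′n) = ≤-trans (mono-≤′ m≤′n) (<⇒≤ (x<x-suc _))

  mono-≤ : ∀ {m n} → m ≤ n → x m ≤ x n
  mono-≤ m≤n = mono-≤′ (≤⇒≤′ m≤n)

  cancel-< : ∀ {m n} → x m < x n → m < n
  cancel-< xm<xn = ≰⇒> λ n≤m → <⇒≱ xm<xn (mono-≤ n≤m)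

  n≤x : ∀ n → n ≤ x n
  n≤x zero    = z≤n
  n≤x (suc n) = ≤-<-trans (n≤x n) (x<x-suc n)

  +-<-later : ∀ {a b q} → a < q → b < q → x a + x b < x q
  +-<-later {q = suc q} a<q b<q =
    ≤-<-trans (+-mono-≤ (mono-≤ (≤-pred a<q)) (mono-≤ (≤-pred b<q))) (x-superIncreasing q)

  private
    larger-top-dominates : ∀ {p q p' q'} → x p' < x q' → q < q' → x q + x p' < x q' + x p
    larger-top-dominates {p} xp'<xq' q<q' =
      <-≤-trans (+-<-later q<q' (cancel-< xp'<xq')) (m≤m+n _ (x p))

  difference-top-unique : ∀ {p q p' q'} → x p < x q → x p' < x q' →
    x q + x p' ≡ x q' + x p → q ≡ q'
  difference-top-unique {q = q} {q' = q'} xp<xq xp'<xq' eq with <-cmp q q'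
  ... | tri< q<q' _ _ = ⊥-elim (<-irrefl eq (larger-top-dominates xp'<xq' q<q'))
  ... | tri≈ _ q≡q' _ = q≡q'
  ... | tri> _ _ q'<q = ⊥-elim (<-irrefl (sym eq) (larger-top-dominates xp<xq q'<q))

Range : (ℕ → ℕ) → SubsetN
Range f m = ∃ λ n → m ≡ f n

push : (ℕ → ℕ) → Family → Family
push f U B = U (λ n → B (f n))

push-isUltrafilter : ∀ {U} f → IsUltrafilter U → IsUltrafilter (push f U)
push-isUltrafilter f U-ultra = record
  { upward = λ A B A⊆B → upward _ _ (λ n → A⊆B (f n))
  ; inter  = λ A B → inter _ _
  ; proper = proper
  ; ultra  = λ A → ultra (λ n → A (f n))
  }
  where open IsUltrafilter U-ultra

module _ {U : Family} (U-ultra : IsUltrafilter U) where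
  open IsUltrafilter U-ultra

  everywhere-∈ : ∀ P → (∀ n → P n) → U P
  everywhere-∈ P P-all with ultra ∅N
  ... | inj₁ U∅  = ⊥-elim (proper U∅)
  ... | inj₂ U∁∅ = upward _ _ (λ n _ → P-all n) U∁∅

  push-∋-range : ∀ f → push f U (Range f)
  push-∋-range f = everywhere-∈ _ λ n → n , refl

  module _ (U-nonprincipal : Nonprincipal U) where

    initial-segment-∉ : ∀ N → ¬ U (λ m → m < N)
    initial-segment-∉ zero    U∅ = proper (upward _ _ (λ _ ()) U∅)
    initial-segment-∉ (suc N) U<1+N with ultra (singletonN N)
    ... | inj₁ U∋N = U-nonprincipal N U∋N
    ... | inj₂ U∌N = initial-segment-∉ N (upward _ _ <N (inter _ _ U<1+N U∌N))
      where
      <N : ∀ m → m < suc N × ¬ m ≡ N → m < N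
      <N m (m<1+N , m≢N) = ≤∧≢⇒< (≤-pred m<1+N) m≢N

    push-nonprincipal : ∀ f → (∀ n → n ≤ f n) → Nonprincipal (push f U)
    push-nonprincipal f n≤f k U∋f⁻¹k = initial-segment-∉ (suc k) (upward _ _ <1+k U∋f⁻¹k)
      where
      <1+k : ∀ n → f n ≡ k → n < suc k
      <1+k n fn≡k = s≤s (≤-trans (n≤f n) (≤-reflexive fn≡k))

    minimum-below-push : ∀ {X} → (∀ V → IsUltrafilter V → Nonprincipal V → V X → U ≤feU V) →
      ∀ f → (∀ n → n ≤ f n) → (∀ n → X (f n)) → Σ SubsetN λ A → U A × A ≤fe Range f
    minimum-below-push U-minimum f n≤f f∈X =
      U-minimum (push f U) (push-isUltrafilter f U-ultra) (push-nonprincipal f n≤f)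
                (everywhere-∈ _ f∈X) (Range f) (push-∋-range f)

    member-unbounded : ∀ {C} → U C → ∀ N → ¬ ¬ ∃ λ m → N ≤ m × C m
    member-unbounded {C} U∋C N ¬above = initial-segment-∉ N (upward _ _ below U∋C)
      where
      below : ∀ m → C m → m < N
      below m m∈C = ≰⇒> λ N≤m → ¬above (m , N≤m , m∈C)

    member-two-elements : ∀ {C} → U C → ¬ ¬ ∃₂ λ a b → a < b × C a × C b
    member-two-elements U∋C ¬pair =
      member-unbounded U∋C 0 λ (a , _ , a∈C) →
      member-unbounded U∋C (suc a) λ (b , a<b , b∈C) → ¬pair (a , b , a<b , a∈C , b∈C)

≤fe-pair : ∀ {A B a b} → A ≤fe B → A a → A b → ∃ λ k → B (a + k) × B (b + k)
≤fe-pair A≤feB a∈A b∈A with A≤feB (_ ∷ _ ∷ []) (a∈A ∷ b∈A ∷ [])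
... | k , a+k∈B ∷ b+k∈B ∷ [] = k , a+k∈B , b+k∈B

evens odds : (ℕ → ℕ) → ℕ → ℕ
evens x n = x (2 * n)
odds  x n = x (suc (2 * n))

module _ (x : ℕ → ℕ) (x-superIncreasing : SuperIncreasing x) where
  open SuperIncreasing x x-superIncreasing

  n≤evens : ∀ n → n ≤ evens x n
  n≤evens n = ≤-trans (m≤n*m n 2) (n≤x (2 * n))

  n≤odds : ∀ n → n ≤ odds x n
  n≤odds n = ≤-trans (m≤n*m n 2) (≤-trans (n≤1+n _) (n≤x (suc (2 * n))))

  gap-not-in-evens-and-odds : ∀ {a b} → a < b →
    (∃ λ k → Range (evens x) (a + k) × Range (evens x) (b + k)) →
    ¬ (∃ λ l → Range (odds x) (a + l) × Range (odds x) (b + l))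
  gap-not-in-evens-and-odds {a} {b} a<b (k , (i , a+k≡) , (j , b+k≡)) (l , (i' , a+l≡) , (j' , b+l≡)) =
    even≢odd j j' (difference-top-unique (translate a+k≡ b+k≡) (translate a+l≡ b+l≡) cross)
    where
    translate : ∀ {k p q} → a + k ≡ x p → b + k ≡ x q → x p < x q
    translate {k} a+k≡xp b+k≡xq = subst₂ _<_ a+k≡xp b+k≡xq (+-monoˡ-< k a<b)

    cross : x (2 * j) + x (suc (2 * i')) ≡ x (suc (2 * j')) + x (2 * i)
    cross = begin
      x (2 * j) + x (suc (2 * i'))  ≡⟨ cong₂ _+_ (sym b+k≡) (sym a+l≡) ⟩
      (b + k) + (a + l)             ≡⟨ swap-translations a b k l ⟩
      (b + l) + (a + k)             ≡⟨ cong₂ _+_ b+l≡ a+k≡ ⟩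
      x (suc (2 * j')) + x (2 * i)  ∎
      where
      open ≡-Reasoning
      swap-translations : ∀ a b k l → (b + k) + (a + l) ≡ (b + l) + (a + k)
      swap-translations = solve-∀

proposition14 : (X : SubsetN) → Infinite X →
    ¬ (Σ Family λ U → IsUltrafilter U × Nonprincipal U × U X ×
    (∀ V → IsUltrafilter V → Nonprincipal V → V X → U ≤feU V))
proposition14 X X-infinite (U , U-ultra , U-nonprincipal , _ , U-minimum)
  with superIncreasing-within X-infinite
... | x , x-superIncreasing , x∈X
  with minimum-below-push U-ultra U-nonprincipal U-minimum
         (evens x) (n≤evens x x-superIncreasing) (λ n → x∈X (2 * n))
     | minimum-below-push U-ultra U-nonprincipal U-minimum
         (odds x) (n≤odds x x-superIncreasing) (λ n → x∈X (suc (2 * n)))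
... | A , U∋A , A≤feEvens | A' , U∋A' , A'≤feOdds =
  member-two-elements U-ultra U-nonprincipal (IsUltrafilter.inter U-ultra A A' U∋A U∋A')
    λ (a , b , a<b , (a∈A , a∈A') , (b∈A , b∈A')) →
      gap-not-in-evens-and-odds x x-superIncreasing a<b
        (≤fe-pair {B = Range (evens x)} A≤feEvens a∈A b∈A)
        (≤fe-pair {B = Range (odds x)} A'≤feOdds a∈A' b∈A')
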